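{- For rational (or real) numbers $k,r,q$ define \[ F(k,r,q)=q^4 - r^4 + \frac{4k}{k^2+1}\,r^2 - 1 . \] Then: (1) $F(k,r,q)=F(k,\pm r,\pm q)$ for all choices of signs; (2) if $k\neq 0$, then $F(k,r,q)=F\!\left(\frac1k,r,q\right)$; (3) if $r\neq 0$, then $F(k,r,q)=r^4\cdot F\!\left(k,\frac1r,\frac{q}{r}\right)$; (4) if $F(k,r,q)=0$ and $k^2-2kr^2+1\neq 0$, then for either choice of sign \[ F\!\left(\frac{(k^2 + 1)q^2 \pm (k^2 - 1)r^2}{k^2-2kr^2 + 1},\,q,\,r\right)=0 . \]
   Formalization: Only the case of rational numbers k, r, q is treated, not that of real numbers. -}

module Defs where

open import Data.Rational
open import Data.Rational.Properties
open import Data.Sum using (inj₁; inj₂)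
open import Relation.Binary.PropositionalEquality using (_≢_)
open import Relation.Nullary using (¬_)

sq-nonNeg : ∀ k → 0ℚ ≤ k * k
sq-nonNeg k with ≤-total 0ℚ k
... | inj₁ 0≤k = ≤-trans (≤-reflexive (sym (*-zeroˡ k))) (*-monoʳ-≤-nonNeg k {{nonNegative 0≤k}} 0≤k)
  where open import Relation.Binary.PropositionalEquality using (sym)
... | inj₂ k≤0 = ≤-trans (≤-reflexive (sym (*-zeroˡ k))) (*-monoʳ-≤-nonPos k {{nonPositive k≤0}} k≤0)
  where open import Relation.Binary.PropositionalEquality using (sym)

k²+1≢0 : ∀ k → k * k + 1ℚ ≢ 0ℚ
k²+1≢0 k eq = <-irrefl (Relation.Binary.PropositionalEquality.sym eq)
  (≤-<-trans (sq-nonNeg k) (≤-<-trans (≤-reflexive (Relation.Binary.PropositionalEquality.sym (+-identityʳ (k * k))))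
     (+-monoʳ-< (k * k) (positive⁻¹ 1ℚ))))
  where import Relation.Binary.PropositionalEquality

div : (p q : ℚ) → q ≢ 0ℚ → ℚ
div p q h = _÷_ p q {{≢-nonZero h}}

F : ℚ → ℚ → ℚ → ℚ
F k r q = q * q * q * q - r * r * r * r
        + div (4ℚ * k) (k * k + 1ℚ) (k²+1≢0 k) * (r * r) - 1ℚ
  where 4ℚ = 1ℚ + 1ℚ + 1ℚ + 1ℚ

{-# OPTIONS --safe #-}
-- Clearing denominators, F k r q = 0 says (k² + 1)(q⁴ − r⁴ − 1) + 4 k r² = 0 and
-- F (N / D) q r = 0 says (N² + D²)(r⁴ − q⁴ − 1) + 4 N D q² = 0. Given the first, and since
-- D = (k² + 1) − 2 k r², the second is equivalent to
-- (N − (k² + 1) q²)² = (k² + 1)² q⁴ − D² = (k² − 1)² r⁴,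
-- which both numerators N = (k² + 1) q² ± (k² − 1) r² satisfy. Parts (1)–(3) are polynomial
-- identities once 1/k and 1/r are eliminated through x · (1/x) = 1.
module Submission where

open import Defs
open import Data.Rational using (ℚ; 0ℚ; 1ℚ; _+_; _-_; _*_; -_; 1/_; ≢-nonZero)
open import Data.Rational.Properties
  using (_≟_; +-*-commutativeRing; +-0-group; *-assoc; *-identityʳ; *-zeroˡ; *-zeroʳ; *-inverseˡ; *-inverseʳ)
open import Algebra.Bundles using (CommutativeRing)
open import Algebra.Properties.Group +-0-group using (x≈y⇒x∙y⁻¹≈ε)
open import Algebra.Properties.CommutativeSemigroup
  (CommutativeRing.*-commutativeSemigroup +-*-commutativeRing) using (xy∙z≈xz∙y)
open import Data.List using ([]; _∷_)
open import Data.Product using (_×_; _,_)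
open import Function using (_∘_)
open import Level using (0ℓ)
open import Relation.Binary.PropositionalEquality
  using (_≡_; _≢_; sym; trans; cong; cong₂; module ≡-Reasoning)
open import Relation.Nullary.Decidable using (dec⇒maybe)
open import Tactic.RingSolver using (solve-∀; solve)
open import Tactic.RingSolver.Core.AlmostCommutativeRing using (AlmostCommutativeRing; fromCommutativeRing)

open ≡-Reasoning

ℚ-ring : AlmostCommutativeRing 0ℓ 0ℓ
ℚ-ring = fromCommutativeRing +-*-commutativeRing (dec⇒maybe ∘ (0ℚ ≟_))

2ℚ 4ℚ : ℚ
2ℚ = 1ℚ + 1ℚ
4ℚ = 1ℚ + 1ℚ + 1ℚ + 1ℚ

p/q*q≡p : ∀ p q (q≢0 : q ≢ 0ℚ) → div p q q≢0 * q ≡ p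
p/q*q≡p p q q≢0 = begin
  p * 1/ q * q    ≡⟨ *-assoc p (1/ q) q ⟩
  p * (1/ q * q)  ≡⟨ cong (p *_) (*-inverseˡ q) ⟩
  p * 1ℚ          ≡⟨ *-identityʳ p ⟩
  p               ∎
  where instance _ = ≢-nonZero q≢0

*-cancelʳ-≡ : ∀ {x y z} → z ≢ 0ℚ → x * z ≡ y * z → x ≡ y
*-cancelʳ-≡ {x} {y} {z} z≢0 xz≡yz = begin
  x                 ≡⟨ sym (p*q/q≡p x) ⟩
  x * z * 1/ z      ≡⟨ cong (_* 1/ z) xz≡yz ⟩
  y * z * 1/ z      ≡⟨ p*q/q≡p y ⟩
  y                 ∎
  where
  instance _ = ≢-nonZero z≢0
  p*q/q≡p : ∀ p → p * z * 1/ z ≡ p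
  p*q/q≡p p = trans (*-assoc p z (1/ z)) (trans (cong (p *_) (*-inverseʳ z)) (*-identityʳ p))

x*y≡0⇒x≡0 : ∀ {x y} → y ≢ 0ℚ → x * y ≡ 0ℚ → x ≡ 0ℚ
x*y≡0⇒x≡0 {y = y} y≢0 xy≡0 = *-cancelʳ-≡ y≢0 (trans xy≡0 (sym (*-zeroˡ y)))

x≢0⇒x*x≢0 : ∀ {x} → x ≢ 0ℚ → x * x ≢ 0ℚ
x≢0⇒x*x≢0 x≢0 = x≢0 ∘ x*y≡0⇒x≡0 x≢0

a*d≡c*b⇒a/b≡c/d : ∀ {a b c d} (b≢0 : b ≢ 0ℚ) (d≢0 : d ≢ 0ℚ) →
                  a * d ≡ c * b → div a b b≢0 ≡ div c d d≢0
a*d≡c*b⇒a/b≡c/d {a} {b} {c} {d} b≢0 d≢0 ad≡cb =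
  *-cancelʳ-≡ b≢0 (*-cancelʳ-≡ d≢0 (begin
    a/b * b * d  ≡⟨ cong (_* d) (p/q*q≡p a b b≢0) ⟩
    a * d        ≡⟨ ad≡cb ⟩
    c * b        ≡⟨ cong (_* b) (sym (p/q*q≡p c d d≢0)) ⟩
    c/d * d * b  ≡⟨ xy∙z≈xz∙y c/d d b ⟩
    c/d * b * d  ∎))
  where
  a/b = div a b b≢0
  c/d = div c d d≢0

-- F k r q unfolds to  q * q * q * q - r * r * r * r + coeff k * (r * r) - 1ℚ,  so the
-- lemmas about that quartic for an arbitrary coefficient c apply to F as they stand.
coeff : ℚ → ℚ
coeff k = div (4ℚ * k) (k * k + 1ℚ) (k²+1≢0 k)

quartic-even-r : ∀ c r q → q * q * q * q - r * r * r * r + c * (r * r) - 1ℚ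
                         ≡ q * q * q * q - (- r) * (- r) * (- r) * (- r) + c * ((- r) * (- r)) - 1ℚ
quartic-even-r = solve-∀ ℚ-ring

quartic-even-q : ∀ c r q → q * q * q * q - r * r * r * r + c * (r * r) - 1ℚ
                         ≡ (- q) * (- q) * (- q) * (- q) - r * r * r * r + c * (r * r) - 1ℚ
quartic-even-q = solve-∀ ℚ-ring

F-even : ∀ k r q → (F k r q ≡ F k (- r) q) × (F k r q ≡ F k r (- q))
                   × (F k r q ≡ F k (- r) (- q))
F-even k r q = quartic-even-r c r q , quartic-even-q c r q
             , trans (quartic-even-r c r q) (quartic-even-q c (- r) q)
  where c = coeff k

4k[x²+1]≡4x[k²+1] : ∀ k x → x * k ≡ 1ℚ → 4ℚ * k * (x * x + 1ℚ) ≡ 4ℚ * x * (k * k + 1ℚ)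
4k[x²+1]≡4x[k²+1] k x xk≡1 = begin
  4ℚ * k * (x * x + 1ℚ)
    ≡⟨ solve (k ∷ x ∷ []) ℚ-ring ⟩
  4ℚ * x * (k * k + 1ℚ) + 4ℚ * (x - k) * (x * k - 1ℚ)
    ≡⟨ cong (λ u → 4ℚ * x * (k * k + 1ℚ) + 4ℚ * (x - k) * (u - 1ℚ)) xk≡1 ⟩
  4ℚ * x * (k * k + 1ℚ) + 4ℚ * (x - k) * (1ℚ - 1ℚ)
    ≡⟨ solve (k ∷ x ∷ []) ℚ-ring ⟩
  4ℚ * x * (k * k + 1ℚ) ∎

F-reciprocal : ∀ k r q (k≢0 : k ≢ 0ℚ) → F k r q ≡ F (div 1ℚ k k≢0) r q
F-reciprocal k r q k≢0 = cong (λ c → q * q * q * q - r * r * r * r + c * (r * r) - 1ℚ)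
  (a*d≡c*b⇒a/b≡c/d {a = 4ℚ * k} {c = 4ℚ * x} (k²+1≢0 k) (k²+1≢0 x)
    (4k[x²+1]≡4x[k²+1] k x (p/q*q≡p 1ℚ k k≢0)))
  where x = div 1ℚ k k≢0

quartic-inversion : ∀ c r q x z → x * r ≡ 1ℚ → z * r ≡ q →
  q * q * q * q - r * r * r * r + c * (r * r) - 1ℚ
    ≡ r * r * r * r * (z * z * z * z - x * x * x * x + c * (x * x) - 1ℚ)
quartic-inversion c r q x z xr≡1 zr≡q = sym (begin
  r * r * r * r * (z * z * z * z - x * x * x * x + c * (x * x) - 1ℚ)
    ≡⟨ solve (c ∷ r ∷ x ∷ z ∷ []) ℚ-ring ⟩
  (z * r) * (z * r) * (z * r) * (z * r) - (x * r) * (x * r) * (x * r) * (x * r)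
    + c * (r * r) * ((x * r) * (x * r)) - r * r * r * r
    ≡⟨ cong₂ (λ u v → u * u * u * u - v * v * v * v + c * (r * r) * (v * v) - r * r * r * r) zr≡q xr≡1 ⟩
  q * q * q * q - 1ℚ * 1ℚ * 1ℚ * 1ℚ + c * (r * r) * (1ℚ * 1ℚ) - r * r * r * r
    ≡⟨ solve (c ∷ r ∷ q ∷ []) ℚ-ring ⟩
  q * q * q * q - r * r * r * r + c * (r * r) - 1ℚ ∎)

F-inversion : ∀ k r q (r≢0 : r ≢ 0ℚ) → F k r q ≡ r * r * r * r * F k (div 1ℚ r r≢0) (div q r r≢0)
F-inversion k r q r≢0 =
  quartic-inversion (coeff k) r q (div 1ℚ r r≢0) (div q r r≢0) (p/q*q≡p 1ℚ r r≢0) (p/q*q≡p q r r≢0)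

clearedF : ℚ → ℚ → ℚ → ℚ
clearedF k s t = (k * k + 1ℚ) * (t * t - s * s - 1ℚ) + 4ℚ * k * s

homogF : ℚ → ℚ → ℚ → ℚ → ℚ
homogF N D s t = (N * N + D * D) * (t * t - s * s - 1ℚ) + 4ℚ * N * D * s

quartic-cleared : ∀ c k r q → c * (k * k + 1ℚ) ≡ 4ℚ * k →
  (q * q * q * q - r * r * r * r + c * (r * r) - 1ℚ) * (k * k + 1ℚ) ≡ clearedF k (r * r) (q * q)
quartic-cleared c k r q cK≡4k = begin
  (q * q * q * q - r * r * r * r + c * (r * r) - 1ℚ) * (k * k + 1ℚ)
    ≡⟨ solve (c ∷ k ∷ r ∷ q ∷ []) ℚ-ring ⟩
  (k * k + 1ℚ) * (q * q * (q * q) - r * r * (r * r) - 1ℚ) + c * (k * k + 1ℚ) * (r * r)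
    ≡⟨ cong (λ a → (k * k + 1ℚ) * (q * q * (q * q) - r * r * (r * r) - 1ℚ) + a * (r * r)) cK≡4k ⟩
  clearedF k (r * r) (q * q) ∎

F*[k²+1]≡clearedF : ∀ k r q → F k r q * (k * k + 1ℚ) ≡ clearedF k (r * r) (q * q)
F*[k²+1]≡clearedF k r q = quartic-cleared (coeff k) k r q (p/q*q≡p _ _ (k²+1≢0 k))

F≡0⇒clearedF≡0 : ∀ k r q → F k r q ≡ 0ℚ → clearedF k (r * r) (q * q) ≡ 0ℚ
F≡0⇒clearedF≡0 k r q F≡0 = begin
  clearedF k (r * r) (q * q)  ≡⟨ sym (F*[k²+1]≡clearedF k r q) ⟩
  F k r q * (k * k + 1ℚ)      ≡⟨ cong (_* (k * k + 1ℚ)) F≡0 ⟩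
  0ℚ * (k * k + 1ℚ)           ≡⟨ *-zeroˡ (k * k + 1ℚ) ⟩
  0ℚ                          ∎

clearedF≡0⇒F≡0 : ∀ k r q → clearedF k (r * r) (q * q) ≡ 0ℚ → F k r q ≡ 0ℚ
clearedF≡0⇒F≡0 k r q cleared≡0 =
  x*y≡0⇒x≡0 (k²+1≢0 k) (trans (F*[k²+1]≡clearedF k r q) cleared≡0)

clearedF-scale : ∀ N D x s t → x * D ≡ N → clearedF x s t * (D * D) ≡ homogF N D s t
clearedF-scale N D x s t xD≡N = begin
  ((x * x + 1ℚ) * (t * t - s * s - 1ℚ) + 4ℚ * x * s) * (D * D)
    ≡⟨ solve (D ∷ x ∷ s ∷ t ∷ []) ℚ-ring ⟩
  ((x * D) * (x * D) + D * D) * (t * t - s * s - 1ℚ) + 4ℚ * (x * D) * D * s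
    ≡⟨ cong (λ n → homogF n D s t) xD≡N ⟩
  homogF N D s t ∎

homogF-swap-identity : ∀ k s t N →
  let K = k * k + 1ℚ
      D = k * k - 2ℚ * k * s + 1ℚ
  in ((N * N + D * D) * (s * s - t * t - 1ℚ) + 4ℚ * N * D * t) * K
     ≡ (2ℚ * D * K - (N * N + D * D)) * (K * (t * t - s * s - 1ℚ) + 4ℚ * k * s)
       - 2ℚ * D * ((N - K * t) * (N - K * t) - (k * k - 1ℚ) * s * ((k * k - 1ℚ) * s))
homogF-swap-identity = solve-∀ ℚ-ring

clearedF≡0⇒homogF≡0 : ∀ k s t N → clearedF k s t ≡ 0ℚ →
  (N - (k * k + 1ℚ) * t) * (N - (k * k + 1ℚ) * t) ≡ (k * k - 1ℚ) * s * ((k * k - 1ℚ) * s) →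
  homogF N (k * k - 2ℚ * k * s + 1ℚ) t s ≡ 0ℚ
clearedF≡0⇒homogF≡0 k s t N cleared≡0 shift² = x*y≡0⇒x≡0 (k²+1≢0 k) (begin
  homogF N D t s * K
    ≡⟨ homogF-swap-identity k s t N ⟩
  w * clearedF k s t - 2ℚ * D * ((N - K * t) * (N - K * t) - (k * k - 1ℚ) * s * ((k * k - 1ℚ) * s))
    ≡⟨ cong₂ (λ a b → w * a - 2ℚ * D * b) cleared≡0 (x≈y⇒x∙y⁻¹≈ε shift²) ⟩
  w * 0ℚ - 2ℚ * D * 0ℚ
    ≡⟨ cong₂ _-_ (*-zeroʳ w) (*-zeroʳ (2ℚ * D)) ⟩
  0ℚ ∎)
  where
  K = k * k + 1ℚ
  D = k * k - 2ℚ * k * s + 1ℚ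
  w = 2ℚ * D * K - (N * N + D * D)

F-zero-transfer : ∀ k r q N → F k r q ≡ 0ℚ →
  (D≢0 : k * k - 2ℚ * k * (r * r) + 1ℚ ≢ 0ℚ) →
  (N - (k * k + 1ℚ) * (q * q)) * (N - (k * k + 1ℚ) * (q * q))
    ≡ (k * k - 1ℚ) * (r * r) * ((k * k - 1ℚ) * (r * r)) →
  F (div N (k * k - 2ℚ * k * (r * r) + 1ℚ) D≢0) q r ≡ 0ℚ
F-zero-transfer k r q N F≡0 D≢0 shift² =
  clearedF≡0⇒F≡0 N/D q r (x*y≡0⇒x≡0 (x≢0⇒x*x≢0 D≢0)
    (trans (clearedF-scale N D N/D (q * q) (r * r) (p/q*q≡p N D D≢0))
           (clearedF≡0⇒homogF≡0 k (r * r) (q * q) N (F≡0⇒clearedF≡0 k r q F≡0) shift²)))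
  where
  D = k * k - 2ℚ * k * (r * r) + 1ℚ
  N/D = div N D D≢0

[a+b-a]²≡b² : ∀ a b → (a + b - a) * (a + b - a) ≡ b * b
[a+b-a]²≡b² = solve-∀ ℚ-ring

[a-b-a]²≡b² : ∀ a b → (a - b - a) * (a - b - a) ≡ b * b
[a-b-a]²≡b² = solve-∀ ℚ-ring

lemma2p2 :
    -- (1) sign invariance in r and q
    (∀ k r q → (F k r q ≡ F k (- r) q) × (F k r q ≡ F k r (- q))
                × (F k r q ≡ F k (- r) (- q)))
    -- (2) k ↦ 1/k
    × (∀ k r q → (hk : k ≢ 0ℚ) → F k r q ≡ F (div 1ℚ k hk) r q)
    -- (3) (r,q) ↦ (1/r, q/r)
    × (∀ k r q → (hr : r ≢ 0ℚ) → F k r q ≡ r * r * r * r * F k (div 1ℚ r hr) (div q r hr))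
    -- (4) both signs
    × (∀ k r q → F k r q ≡ 0ℚ → (hD : k * k - (1ℚ + 1ℚ) * k * (r * r) + 1ℚ ≢ 0ℚ) →
         (F (div ((k * k + 1ℚ) * (q * q) + (k * k - 1ℚ) * (r * r)) (k * k - (1ℚ + 1ℚ) * k * (r * r) + 1ℚ) hD) q r ≡ 0ℚ)
         × (F (div ((k * k + 1ℚ) * (q * q) - (k * k - 1ℚ) * (r * r)) (k * k - (1ℚ + 1ℚ) * k * (r * r) + 1ℚ) hD) q r ≡ 0ℚ))
lemma2p2 = F-even , F-reciprocal , F-inversion , λ k r q F≡0 D≢0 →
  let t = (k * k + 1ℚ) * (q * q)
      m = (k * k - 1ℚ) * (r * r)
  in F-zero-transfer k r q (t + m) F≡0 D≢0 ([a+b-a]²≡b² t m)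
   , F-zero-transfer k r q (t - m) F≡0 D≢0 ([a-b-a]²≡b² t m)
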